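{- Let $\Delta_{m,\mathbf a}^{(\mathbf r)}$ be a generalized primitive shifted $m$-gonal form. (1) For every odd prime $p$ dividing $m-2$, $\Delta_{m,\mathbf a}^{(\mathbf r)}$ is $\mathbb Z_p$-universal. (2) If $m\not\equiv 0\pmod 4$, then $\Delta_{m,\mathbf a}^{(\mathbf r)}$ is $\mathbb Z_2$-universal.
   Context: For an integer $m\ge 3$ and an integer $r$ with $0\le r\le m-2$ and $\gcd(r,m-2)=1$, let $P_m^{(r)}(x)=\frac{m-2}{2}x^2-\frac{m-2-2r}{2}x$. For positive integers $a_1,\dots,a_n$ and such levels $r_1,\dots,r_n$, the generalized shifted $m$-gonal form is $\Delta_{m,\mathbf a}^{(\mathbf r)}(\mathbf x)=\sum_{i=1}^n a_iP_m^{(r_i)}(x_i)$; it is primitive if $\gcd(a_1,\dots,a_n)=1$. For a prime $p$, the form is $\mathbb Z_p$-universal if $\Delta_{m,\mathbf a}^{(\mathbf r)}(\mathbf x)=N$ has a solution $\mathbf x\in\mathbb Z_p^n$ for every $N\in\mathbb Z_p$. -}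

module Defs where

open import Data.Nat as ℕ using (ℕ; zero; suc; _∸_; _^_)
open import Data.Nat.GCD using (gcd)
open import Data.Integer using (ℤ; +_; _+_; _-_; _*_)
open import Data.Integer.Divisibility using (_∣_)
open import Data.Fin using (Fin; zero; suc)
open import Data.Product using (∃; Σ; _×_)

_≡_[mod_] : ℤ → ℤ → ℕ → Set
a ≡ b [mod q ] = (+ q) ∣ (a - b)

-- p-adic integers as the inverse limit  lim Z/p^k Z :
-- a coherent sequence of integer representatives, component k being taken mod p^k
record ℤ[_] (p : ℕ) : Set where
  field
    seq : ℕ → ℤ
    coh : ∀ k → seq (suc k) ≡ seq k [mod p ^ k ]
open ℤ[_] public

Σℤ : (n : ℕ) → (Fin n → ℤ) → ℤ
Σℤ zero    f = + 0
Σℤ (suc n) f = f zero + Σℤ n (λ i → f (suc i))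

gcdFam : (n : ℕ) → (Fin n → ℕ) → ℕ
gcdFam zero    a = 0
gcdFam (suc n) a = gcd (a zero) (gcdFam n (λ i → a (suc i)))

twiceP : ℕ → ℕ → ℤ → ℤ
twiceP m r x = (+ (m ∸ 2)) * x * x - ((+ (m ∸ 2)) - (+ (2 ℕ.* r))) * x

twiceΔ : ℕ → (n : ℕ) → (Fin n → ℕ) → (Fin n → ℕ) → (Fin n → ℤ) → ℤ
twiceΔ m n a r x = Σℤ n (λ i → (+ a i) * twiceP m (r i) (x i))

ValidLevel : ℕ → ℕ → Set
ValidLevel m r = (r ℕ.≤ m ∸ 2) × gcd r (m ∸ 2) ≡ℕ 1
  where open import Relation.Binary.PropositionalEquality renaming (_≡_ to _≡ℕ_)

-- The equation Δ(x) = N is expressed as 2Δ(x) = 2N in Z_p (Z_p is torsion-free),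
-- i.e. componentwise modulo p^k for every k.
ZpUniversal : (p m n : ℕ) → (Fin n → ℕ) → (Fin n → ℕ) → Set
ZpUniversal p m n a r =
  (N : ℤ[ p ]) → Σ (Fin n → ℤ[ p ]) λ x →
    ∀ k → twiceΔ m n a r (λ i → seq (x i) k) ≡ (+ 2) * seq N k [mod p ^ k ]

{-# OPTIONS --safe #-}
-- Primitivity gives a coefficient a_i prime to p, and setting every other variable to 0
-- reduces the claim to the ℤ_p-universality of the single summand a_i P_m^{(r_i)}.
-- Up to the factor 2 (removed by x = 2y when m is odd, divided out when m ≡ 2 mod 4) this
-- summand is a quadratic α x² + β x with p ∣ α and β a unit mod p: for odd p because
-- p ∣ m − 2 and p ∤ 2 a_i r_i, for p = 2 because a_i is odd together with m − 2 (m odd)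
-- or r_i (m ≡ 2 mod 4).
-- All its difference quotients are then ≡ β mod p, so Newton's iteration with one fixed
-- inverse of β converges in ℤ_p.
module Submission where

open import Defs
open import Data.Nat using (ℕ; _≤_; _>_; _∸_)
open import Data.Nat.Divisibility using (_∣_)
open import Data.Nat.Primality using (Prime)
open import Data.Fin using (Fin)
open import Data.Product using (_×_)
open import Relation.Nullary using (¬_)
open import Relation.Binary.PropositionalEquality using (_≡_)

open import Data.Nat as ℕ using (zero; suc; _^_)
open import Data.Nat.Properties using (<⇒≤; m∸n+n≡m; +-comm)
open import Data.Nat.Divisibility using (_∣?_; _∣0; ∣-refl; ∣1⇒≡1; ∣m∣n⇒∣m+n; *-monoˡ-∣; divides)
open import Data.Nat.GCD using (gcd-greatest; module Bézout)
open import Data.Nat.Coprimality using (Coprime; coprime-Bézout; gcd≡1⇒coprime)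
open import Data.Nat.Primality using (prime⇒irreducible; prime⇒nonTrivial; prime[2])
open import Data.Nat.Base using (nonTrivial⇒≢1)
open import Data.Integer using (ℤ; +_; -_; _+_; _-_; _*_)
open import Data.Integer.Properties using (*-assoc; pos-*; pos-+; *-identityʳ; +-identityˡ; +-identityʳ)
import Data.Integer.Divisibility.Signed as ℤᵈ
open import Data.Integer.Divisibility.Signed using (∣ᵤ⇒∣; ∣⇒∣ᵤ)
open import Data.Integer.Tactic.RingSolver using (solve-∀)
open import Data.Fin using (zero; suc)
open import Data.Fin.Properties using (¬∀⟶∃¬)
open import Data.Product using (Σ; ∃; _,_)
open import Data.Sum using (inj₁; inj₂)
open import Function using (_∘_)
open import Relation.Nullary using (yes; no; contradiction)
open import Relation.Binary.PropositionalEquality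
  using (_≢_; refl; sym; trans; cong; cong₂; subst; subst₂; module ≡-Reasoning)

*-congˡ-mod : ∀ {q a b} c → a ≡ b [mod q ] → (c * a) ≡ (c * b) [mod q ]
*-congˡ-mod {q} {a} {b} c a≡b = ∣⇒∣ᵤ (subst (+ q ℤᵈ.∣_) (distrib c a b) (ℤᵈ.∣n⇒∣m*n c (∣ᵤ⇒∣ a≡b)))
  where
  distrib : ∀ c a b → c * (a - b) ≡ c * a - c * b
  distrib = solve-∀

*-pres-∣ : ∀ {d e x y} → d ℤᵈ.∣ x → e ℤᵈ.∣ y → d * e ℤᵈ.∣ x * y
*-pres-∣ {d} {e} (ℤᵈ.divides q refl) (ℤᵈ.divides r refl) = ℤᵈ.divides (q * r) (interchange q d r e)
  where
  interchange : ∀ q d r e → (q * d) * (r * e) ≡ (q * r) * (d * e)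
  interchange = solve-∀

zeroₚ : ∀ {p} → ℤ[ p ]
zeroₚ {p} = record { seq = λ _ → + 0 ; coh = λ k → (p ^ k) ∣0 }

scale : ∀ {p} → ℤ → ℤ[ p ] → ℤ[ p ]
scale c x = record { seq = λ k → c * seq x k ; coh = λ k → *-congˡ-mod c (coh x k) }

ZpSurjective : ℕ → (ℤ → ℤ) → Set
ZpSurjective p F = (c : ℤ[ p ]) → Σ ℤ[ p ] λ y → ∀ k → F (seq y k) ≡ seq c k [mod p ^ k ]

hensel : ∀ {p} (F : ℤ → ℤ) (D : ℤ → ℤ → ℤ) (u : ℤ) →
         (∀ x y → F x - F y ≡ (x - y) * D x y) →
         (∀ x y → + p ℤᵈ.∣ + 1 - u * D x y) →
         ZpSurjective p F
hensel {p} F D u F-diff D-unit c =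
  record { seq = y ; coh = ∣⇒∣ᵤ ∘ y-coh } , ∣⇒∣ᵤ ∘ y-solves
  where
  error : ℕ → ℤ
  y : ℕ → ℤ
  error k = F (y k) - seq c (suc k)
  y zero    = + 0
  y (suc k) = y k - u * error k

  y-solves : ∀ k → + (p ^ k) ℤᵈ.∣ F (y k) - seq c k

  error-small : ∀ k → + (p ^ k) ℤᵈ.∣ error k
  error-small k = subst (_ ℤᵈ.∣_) (telescope (F (y k)) (seq c k) (seq c (suc k)))
                        (ℤᵈ.∣m∣n⇒∣m-n (y-solves k) (∣ᵤ⇒∣ (coh c k)))
    where
    telescope : ∀ a b c → (a - b) - (c - b) ≡ a - c
    telescope = solve-∀

  y-coh : ∀ k → + (p ^ k) ℤᵈ.∣ y (suc k) - y k
  y-coh k = subst (_ ℤᵈ.∣_) (step (y k) u (error k)) (ℤᵈ.∣n⇒∣m*n (- u) (error-small k))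
    where
    step : ∀ y u e → - u * e ≡ (y - u * e) - y
    step = solve-∀

  -- The new residual is (1 − u D) times the old one, which gains a factor p.
  y-solves zero    = ℤᵈ.divides (F (+ 0) - seq c 0) (sym (*-identityʳ _))
  y-solves (suc k) = subst₂ ℤᵈ._∣_ (sym (pos-* p (p ^ k))) residual
                            (*-pres-∣ (D-unit (y (suc k)) (y k)) (error-small k))
    where
    open ≡-Reasoning
    y′ = y (suc k)
    e  = error k
    residual : (+ 1 - u * D y′ (y k)) * e ≡ F y′ - seq c (suc k)
    residual = begin
      (+ 1 - u * D y′ (y k)) * e         ≡⟨ expand (y k) u e (D y′ (y k)) ⟩
      (y′ - y k) * D y′ (y k) + e        ≡⟨ cong (_+ e) (sym (F-diff y′ (y k))) ⟩
      (F y′ - F (y k)) + e               ≡⟨ telescope (F y′) (F (y k)) (seq c (suc k)) ⟩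
      F y′ - seq c (suc k)               ∎
      where
      expand : ∀ y u e d → (+ 1 - u * d) * e ≡ ((y - u * e) - y) * d + e
      expand = solve-∀
      telescope : ∀ a b c → (a - b) + (b - c) ≡ a - c
      telescope = solve-∀

UnitMod : ℕ → ℤ → Set
UnitMod p a = ∃ λ u → + p ℤᵈ.∣ + 1 - u * a

unitMod-* : ∀ {p a b} → UnitMod p a → UnitMod p b → UnitMod p (a * b)
unitMod-* {p} {a} {b} (u , ua≡1) (v , vb≡1) =
  u * v , subst (_ ℤᵈ.∣_) (split u a v b) (ℤᵈ.∣m∣n⇒∣m+n ua≡1 (ℤᵈ.∣n⇒∣m*n (u * a) vb≡1))
  where
  split : ∀ u a v b → (+ 1 - u * a) + u * a * (+ 1 - v * b) ≡ + 1 - u * v * (a * b)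
  split = solve-∀

unitMod-+ : ∀ {p a b} → UnitMod p a → + p ℤᵈ.∣ b → UnitMod p (a + b)
unitMod-+ {p} {a} {b} (u , ua≡1) p∣b =
  u , subst (_ ℤᵈ.∣_) (split u a b) (ℤᵈ.∣m∣n⇒∣m-n ua≡1 (ℤᵈ.∣n⇒∣m*n u p∣b))
  where
  split : ∀ u a b → (+ 1 - u * a) - u * b ≡ + 1 - u * (a + b)
  split = solve-∀

unitMod-neg : ∀ {p a} → UnitMod p a → UnitMod p (- a)
unitMod-neg {p} {a} (u , ua≡1) = - u , subst (λ z → + p ℤᵈ.∣ + 1 - z) (neg-cancel u a) ua≡1
  where
  neg-cancel : ∀ u a → u * a ≡ - u * - a
  neg-cancel = solve-∀

prime∤⇒unitMod : ∀ {p n} → Prime p → ¬ p ∣ n → UnitMod p (+ n)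
prime∤⇒unitMod {p} {n} p-prime p∤n with coprime-Bézout n-coprime-p
  where
  n-coprime-p : Coprime n p
  n-coprime-p (d∣n , d∣p) with prime⇒irreducible p-prime d∣p
  ... | inj₁ d≡1 = d≡1
  ... | inj₂ refl = contradiction d∣n p∤n
... | Bézout.+- x y 1+yp≡xn = + x , ℤᵈ.divides (- + y) (begin
  + 1 - + x * + n          ≡⟨ cong (λ z → + 1 - z) (sym (pos-* x n)) ⟩
  + 1 - + (x ℕ.* n)        ≡⟨ cong (λ z → + 1 - + z) (sym 1+yp≡xn) ⟩
  + 1 - + (1 ℕ.+ y ℕ.* p)  ≡⟨ cong (λ z → + 1 - z) (trans (pos-+ 1 (y ℕ.* p))
                                                          (cong (_+_ (+ 1)) (pos-* y p))) ⟩
  + 1 - (+ 1 + + y * + p)  ≡⟨ cancel (+ y) (+ p) ⟩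
  - + y * + p              ∎)
  where
  open ≡-Reasoning
  cancel : ∀ y p → + 1 - (+ 1 + y * p) ≡ - y * p
  cancel = solve-∀
... | Bézout.-+ x y 1+xn≡yp = - + x , ℤᵈ.divides (+ y) (begin
  + 1 - - + x * + n        ≡⟨ unfold (+ x) (+ n) ⟩
  + 1 + + x * + n          ≡⟨ cong (_+_ (+ 1)) (sym (pos-* x n)) ⟩
  + (1 ℕ.+ x ℕ.* n)        ≡⟨ cong +_ 1+xn≡yp ⟩
  + (y ℕ.* p)              ≡⟨ pos-* y p ⟩
  + y * + p                ∎)
  where
  open ≡-Reasoning
  unfold : ∀ x n → + 1 - - x * n ≡ + 1 + x * n
  unfold = solve-∀

-- The difference quotient α (x + y) + β is ≡ β modulo p, so one inverse of β serves throughout.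
quadratic-ZpSurjective : ∀ {p} α β → + p ℤᵈ.∣ α → UnitMod p β → ZpSurjective p (λ x → α * x * x + β * x)
quadratic-ZpSurjective {p} α β p∣α (u , uβ≡1) =
  hensel (λ x → α * x * x + β * x) (λ x y → α * (x + y) + β) u
    (difference α β)
    (λ x y → subst (_ ℤᵈ.∣_) (split α β u x y) (ℤᵈ.∣m∣n⇒∣m-n uβ≡1 (ℤᵈ.∣n⇒∣m*n (u * (x + y)) p∣α)))
  where
  difference : ∀ α β x y → (α * x * x + β * x) - (α * y * y + β * y) ≡ (x - y) * (α * (x + y) + β)
  difference = solve-∀
  split : ∀ α β u x y → (+ 1 - u * β) - u * (x + y) * α ≡ + 1 - u * (α * (x + y) + β)
  split = solve-∀

ZpUniversal₁ : (p m A r : ℕ) → Set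
ZpUniversal₁ p m A r =
  (N : ℤ[ p ]) → Σ ℤ[ p ] λ x → ∀ k → (+ A * twiceP m r (seq x k)) ≡ (+ 2 * seq N k) [mod p ^ k ]

twiceP-as-polynomial : ∀ m r M x → + (m ∸ 2) ≡ M → twiceP m r x ≡ M * x * x - (M - + 2 * + r) * x
twiceP-as-polynomial m r M x refl = cong (λ R → M * x * x - (M - R) * x) (pos-* 2 r)

ZpSurjective⇒ZpUniversal₁ : ∀ {p m A r} (s t c : ℤ) {Q : ℤ → ℤ} → t * c ≡ + 2 →
  (∀ y → + A * twiceP m r (s * y) ≡ t * Q y) → ZpSurjective p Q → ZpUniversal₁ p m A r
ZpSurjective⇒ZpUniversal₁ {p} s t c tc≡2 rescale Q-surjective N with Q-surjective (scale c N)
... | y , Qy≡cN = scale s y , λ k →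
  subst₂ (λ a b → a ≡ b [mod p ^ k ])
         (sym (rescale (seq y k)))
         (trans (sym (*-assoc t c (seq N k))) (cong (_* seq N k) tc≡2))
         (*-congˡ-mod t (Qy≡cN k))

single : ∀ {p n} → Fin n → ℤ[ p ] → Fin n → ℤ[ p ]
single zero    x zero    = x
single zero    x (suc j) = zeroₚ
single (suc i) x zero    = zeroₚ
single (suc i) x (suc j) = single i x j

*-twiceP-zero : ∀ A m r → + A * twiceP m r (+ 0) ≡ + 0
*-twiceP-zero A m r = trans (cong (+ A *_) (twiceP-as-polynomial m r (+ (m ∸ 2)) (+ 0) refl))
                            (vanish (+ A) (+ (m ∸ 2)) (+ r))
  where
  vanish : ∀ A M r → A * (M * + 0 * + 0 - (M - + 2 * r) * + 0) ≡ + 0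
  vanish = solve-∀

twiceΔ-zero : ∀ m n a r → twiceΔ m n a r (λ _ → + 0) ≡ + 0
twiceΔ-zero m zero    a r = refl
twiceΔ-zero m (suc n) a r =
  cong₂ _+_ (*-twiceP-zero (a zero) m (r zero)) (twiceΔ-zero m n (a ∘ suc) (r ∘ suc))

twiceΔ-single : ∀ {p} m n a r (i : Fin n) (x : ℤ[ p ]) k →
  twiceΔ m n a r (λ j → seq (single i x j) k) ≡ + a i * twiceP m (r i) (seq x k)
twiceΔ-single m (suc n) a r zero x k =
  trans (cong (_+_ (+ a zero * twiceP m (r zero) (seq x k))) (twiceΔ-zero m n (a ∘ suc) (r ∘ suc)))
        (+-identityʳ _)
twiceΔ-single m (suc n) a r (suc i) x k =
  trans (cong₂ _+_ (*-twiceP-zero (a zero) m (r zero)) (twiceΔ-single m n (a ∘ suc) (r ∘ suc) i x k))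
        (+-identityˡ _)

ZpUniversal₁⇒ZpUniversal : ∀ {p} m n a r (i : Fin n) → ZpUniversal₁ p m (a i) (r i) → ZpUniversal p m n a r
ZpUniversal₁⇒ZpUniversal {p} m n a r i summand-universal N with summand-universal N
... | x , solves = single i x , λ k →
  subst (λ v → v ≡ (+ 2 * seq N k) [mod p ^ k ]) (sym (twiceΔ-single m n a r i x k)) (solves k)

gcdFam-greatest : ∀ {d} n (a : Fin n → ℕ) → (∀ i → d ∣ a i) → d ∣ gcdFam n a
gcdFam-greatest zero    a d∣a = _ ∣0
gcdFam-greatest (suc n) a d∣a = gcd-greatest (d∣a zero) (gcdFam-greatest n (a ∘ suc) (d∣a ∘ suc))

gcdFam≡1⇒∃∤ : ∀ {d} n (a : Fin n → ℕ) → d ≢ 1 → gcdFam n a ≡ 1 → ∃ λ i → ¬ d ∣ a i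
gcdFam≡1⇒∃∤ {d} n a d≢1 gcd≡1 = ¬∀⟶∃¬ n (λ i → d ∣ a i) (λ i → d ∣? a i)
  (λ d∣a → d≢1 (∣1⇒≡1 (subst (d ∣_) gcd≡1 (gcdFam-greatest n a d∣a))))

validLevel-∤ : ∀ {d m r} → ValidLevel m r → d ≢ 1 → d ∣ m ∸ 2 → ¬ d ∣ r
validLevel-∤ (_ , gcd≡1) d≢1 d∣M d∣r = d≢1 (gcd≡1⇒coprime gcd≡1 (d∣r , d∣M))

prime⇒≢1 : ∀ {p} → Prime p → p ≢ 1
prime⇒≢1 p-prime = nonTrivial⇒≢1 {{prime⇒nonTrivial p-prime}}

odd-prime∤2 : ∀ {p} → Prime p → ¬ 2 ∣ p → ¬ p ∣ 2
odd-prime∤2 p-prime 2∤p p∣2 with prime⇒irreducible prime[2] p∣2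
... | inj₁ p≡1  = prime⇒≢1 p-prime p≡1
... | inj₂ refl = 2∤p ∣-refl

ZpUniversal₁-odd : ∀ {p m A r} → Prime p → ¬ 2 ∣ p → p ∣ m ∸ 2 → ¬ p ∣ A → ¬ p ∣ r →
                   ZpUniversal₁ p m A r
ZpUniversal₁-odd {p} {m} {A} {r} p-prime 2∤p p∣M p∤A p∤r =
  ZpSurjective⇒ZpUniversal₁ {m = m} {A} {r} (+ 1) (+ 1) (+ 2) refl rescale
    (quadratic-ZpSurjective (+ A * M) (+ A * (+ 2 * + r - M))
      (ℤᵈ.∣n⇒∣m*n (+ A) p∣Mℤ)
      (unitMod-* (unit p∤A) (unitMod-+ (unitMod-* (unit (odd-prime∤2 p-prime 2∤p)) (unit p∤r))
                                       (ℤᵈ.∣m⇒∣-m p∣Mℤ))))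
  where
  M = + (m ∸ 2)
  p∣Mℤ : + p ℤᵈ.∣ M
  p∣Mℤ = ∣ᵤ⇒∣ p∣M
  unit : ∀ {n} → ¬ p ∣ n → UnitMod p (+ n)
  unit = prime∤⇒unitMod p-prime
  rescale : ∀ y → + A * twiceP m r (+ 1 * y) ≡ + 1 * (+ A * M * y * y + + A * (+ 2 * + r - M) * y)
  rescale y = trans (cong (+ A *_) (twiceP-as-polynomial m r M (+ 1 * y) refl)) (identity (+ A) M (+ r) y)
    where
    identity : ∀ A M r y → A * (M * (+ 1 * y) * (+ 1 * y) - (M - + 2 * r) * (+ 1 * y))
                         ≡ + 1 * (A * M * y * y + A * (+ 2 * r - M) * y)
    identity = solve-∀

-- Substituting x = 2y removes the factor 2 of the equation.
ZpUniversal₁-2-odd : ∀ {m A r} → ¬ 2 ∣ m ∸ 2 → ¬ 2 ∣ A → ZpUniversal₁ 2 m A r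
ZpUniversal₁-2-odd {m} {A} {r} 2∤M 2∤A =
  ZpSurjective⇒ZpUniversal₁ {m = m} {A} {r} (+ 2) (+ 2) (+ 1) refl rescale
    (quadratic-ZpSurjective (+ A * (+ 2 * M)) (+ A * (- M + + 2 * + r))
      (ℤᵈ.∣n⇒∣m*n (+ A) (ℤᵈ.∣m⇒∣m*n M ℤᵈ.∣-refl))
      (unitMod-* (unit 2∤A) (unitMod-+ (unitMod-neg (unit 2∤M)) (ℤᵈ.∣m⇒∣m*n (+ r) ℤᵈ.∣-refl))))
  where
  M = + (m ∸ 2)
  unit : ∀ {n} → ¬ 2 ∣ n → UnitMod 2 (+ n)
  unit = prime∤⇒unitMod prime[2]
  rescale : ∀ y → + A * twiceP m r (+ 2 * y)
                ≡ + 2 * (+ A * (+ 2 * M) * y * y + + A * (- M + + 2 * + r) * y)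
  rescale y = trans (cong (+ A *_) (twiceP-as-polynomial m r M (+ 2 * y) refl)) (identity (+ A) M (+ r) y)
    where
    identity : ∀ A M r y → A * (M * (+ 2 * y) * (+ 2 * y) - (M - + 2 * r) * (+ 2 * y))
                         ≡ + 2 * (A * (+ 2 * M) * y * y + A * (- M + + 2 * r) * y)
    identity = solve-∀

ZpUniversal₁-2-even : ∀ {m A r h} → m ∸ 2 ≡ h ℕ.* 2 → 2 ∣ h → ¬ 2 ∣ A → ¬ 2 ∣ r → ZpUniversal₁ 2 m A r
ZpUniversal₁-2-even {m} {A} {r} {h} M≡h*2 2∣h 2∤A 2∤r =
  ZpSurjective⇒ZpUniversal₁ {m = m} {A} {r} (+ 1) (+ 2) (+ 1) refl rescale
    (quadratic-ZpSurjective (+ A * + h) (+ A * (+ r - + h))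
      (ℤᵈ.∣n⇒∣m*n (+ A) 2∣hℤ)
      (unitMod-* (unit 2∤A) (unitMod-+ (unit 2∤r) (ℤᵈ.∣m⇒∣-m 2∣hℤ))))
  where
  2∣hℤ : + 2 ℤᵈ.∣ + h
  2∣hℤ = ∣ᵤ⇒∣ 2∣h
  unit : ∀ {n} → ¬ 2 ∣ n → UnitMod 2 (+ n)
  unit = prime∤⇒unitMod prime[2]
  M≡h*2ℤ : + (m ∸ 2) ≡ + h * + 2
  M≡h*2ℤ = trans (cong +_ M≡h*2) (pos-* h 2)
  rescale : ∀ y → + A * twiceP m r (+ 1 * y) ≡ + 2 * (+ A * + h * y * y + + A * (+ r - + h) * y)
  rescale y = trans (cong (+ A *_) (twiceP-as-polynomial m r (+ h * + 2) (+ 1 * y) M≡h*2ℤ))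
                    (identity (+ A) (+ h) (+ r) y)
    where
    identity : ∀ A h r y → A * (h * + 2 * (+ 1 * y) * (+ 1 * y) - (h * + 2 - + 2 * r) * (+ 1 * y))
                         ≡ + 2 * (A * h * y * y + A * (r - h) * y)
    identity = solve-∀

2∤n⇒2∣1+n : ∀ n → ¬ 2 ∣ n → 2 ∣ suc n
2∤n⇒2∣1+n zero          2∤0   = contradiction (2 ∣0) 2∤0
2∤n⇒2∣1+n (suc zero)    _     = ∣-refl
2∤n⇒2∣1+n (suc (suc n)) 2∤2+n = ∣m∣n⇒∣m+n ∣-refl (2∤n⇒2∣1+n n (2∤2+n ∘ ∣m∣n⇒∣m+n ∣-refl))

ZpUniversal₁-2 : ∀ {m A r} → 3 ≤ m → ¬ 4 ∣ m → ValidLevel m r → ¬ 2 ∣ A → ZpUniversal₁ 2 m A r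
ZpUniversal₁-2 {m} {A} {r} m≥3 4∤m valid 2∤A with 2 ∣? m ∸ 2
... | no 2∤M = ZpUniversal₁-2-odd {m} {A} {r} 2∤M 2∤A
... | yes 2∣M@(divides h M≡h*2) with 2 ∣? h
...   | yes 2∣h = ZpUniversal₁-2-even {m} {A} {r} M≡h*2 2∣h 2∤A (validLevel-∤ {m = m} valid (λ ()) 2∣M)
...   | no 2∤h  = contradiction (subst (4 ∣_) 1+h*2≡m (*-monoˡ-∣ 2 (2∤n⇒2∣1+n h 2∤h))) 4∤m
  where
  open ≡-Reasoning
  1+h*2≡m : suc h ℕ.* 2 ≡ m
  1+h*2≡m = begin
    2 ℕ.+ h ℕ.* 2    ≡⟨ +-comm 2 (h ℕ.* 2) ⟩
    h ℕ.* 2 ℕ.+ 2    ≡⟨ cong (ℕ._+ 2) M≡h*2 ⟨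
    m ∸ 2 ℕ.+ 2      ≡⟨ m∸n+n≡m (<⇒≤ m≥3) ⟩
    m                ∎

proposition2p1 : (m : ℕ) → 3 ≤ m → (n : ℕ) → (a : Fin n → ℕ) → (r : Fin n → ℕ) →
    (∀ i → a i > 0) → (∀ i → ValidLevel m (r i)) → gcdFam n a ≡ 1 →
    ((p : ℕ) → Prime p → ¬ (2 ∣ p) → p ∣ (m ∸ 2) → ZpUniversal p m n a r)
    × (¬ (4 ∣ m) → ZpUniversal 2 m n a r)
proposition2p1 m m≥3 n a r _ valid a-primitive = odd-part , two-part
  -- positivity of the coefficients plays no role over ℤ_p
  where
  odd-part : (p : ℕ) → Prime p → ¬ (2 ∣ p) → p ∣ (m ∸ 2) → ZpUniversal p m n a r
  odd-part p p-prime 2∤p p∣M with gcdFam≡1⇒∃∤ n a (prime⇒≢1 p-prime) a-primitive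
  ... | i , p∤aᵢ = ZpUniversal₁⇒ZpUniversal m n a r i
    (ZpUniversal₁-odd {m = m} p-prime 2∤p p∣M p∤aᵢ
      (validLevel-∤ {m = m} (valid i) (prime⇒≢1 p-prime) p∣M))

  two-part : ¬ (4 ∣ m) → ZpUniversal 2 m n a r
  two-part 4∤m with gcdFam≡1⇒∃∤ n a (λ ()) a-primitive
  ... | i , 2∤aᵢ = ZpUniversal₁⇒ZpUniversal m n a r i (ZpUniversal₁-2 m≥3 4∤m (valid i) 2∤aᵢ)
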